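{- Let $N\ge2$, let $y_0<y_1<\dots<y_N$ be positive integers and let $x$ be a positive integer. Let $x^\bullet\in\{x',x\}$ and $y_1^\bullet\in\{y_1',y_1\}$ with $x-x^\bullet=y_1-y_1^\bullet$, and let $y_0^\circ\in\{y_0',y_0\}$ be arbitrary. If $y_{i-1}<x\le y_i$ for some $i\ge2$, then $$x^\bullet\,y_Ny_{N-1}\cdots y_1y_0^\circ\ \overset{\mathrm{dec}}\sim\ y_Ny_{N-1}\cdots y_{i+1}\,x\,y_{i-1}\cdots y_2\,y_1^\bullet\,y_i\,y_0^\circ.$$ If instead $x\le y_1$, then $x^\bullet\,y_Ny_{N-1}\cdots y_1y_0^\circ\ \overset{\mathrm{dec}}\sim\ y_Ny_{N-1}\cdots y_2\,x^\bullet\,y_1y_0^\circ$.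
   Context: Primed numbers: for an integer $i$, $i':=i-\tfrac12$; a primed word is a finite sequence of elements of $\{1'<1<2'<2<\cdots\}$. The relation $\overset{\mathrm{dec}}\sim$ is the smallest equivalence relation on primed words such that $a\sim u$, $b\sim v$ imply $ab\sim uv$ and which contains, for all unprimed positive integers $a,b,c,d$ and all $a^\bullet,a^\circ\in\{a',a\}$, $b^\bullet,b^\circ\in\{b',b\}$, $c^\bullet,c^\circ\in\{c',c\}$ with $a-a^\bullet=b-b^\bullet=c-c^\bullet$ and $a-a^\circ=b-b^\circ=c-c^\circ$: (1) $a^\bullet b\sim a^\bullet b'$ if $a\le b$; (2) $b a^\bullet\sim b'a^\bullet$ if $a<b$; (3) $a^\bullet b d c^\circ\sim a^\bullet d b^\circ c$ if $a\le b\le c<d$; (4) $a^\bullet c d b^\circ\sim a^\bullet c b^\circ d$ if $a\le b<c\le d$; (5) $d a^\bullet c b^\circ\sim a^\bullet d c b^\circ$ if $a\le b<c<d$; (6) $b a^\bullet d c^\circ\sim b^\circ d a^\bullet c$ if $a<b\le c<d$; (7) $c b^\bullet d a^\circ\sim c^\bullet d b a^\circ$ if $a<b<c\le d$; (8) $d b^\bullet c a^\circ\sim b^\bullet d c a^\circ$ if $a<b\le c<d$; (9) $b^\bullet c d a^\circ\sim b^\bullet c a^\circ d$ if $a<b\le c\le d$; (10) $c a^\bullet d b^\circ\sim c^\circ d a^\bullet b$ if $a\le b<c\le d$. Unannotated letters in words are unprimed. -}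

module Defs where

open import Data.Nat using (ℕ; zero; suc; _+_; _≤_; _<_)
open import Data.Bool using (Bool; true; false)
open import Data.List using (List; []; _∷_; _++_)

-- A primed letter: value n with a flag; (mk n true) is n' = n - 1/2,
-- (mk n false) is the unprimed n.
record Letter : Set where
  constructor mk
  field
    val    : ℕ
    primed : Bool

Word : Set
Word = List Letter

u : ℕ → Letter
u n = mk n false

p′ : ℕ → Letter
p′ n = mk n true

-- The condition a - a• = b - b• = c - c• says that a•, b•, c• share a
-- common primedness flag; a bullet flag is written `s`, a circle flag `t`.
-- In every generator, a is the least of the letters, so "positive" is 1 ≤ a.
infix 4 _∼_
data _∼_ : Word → Word → Set where
  ∼-refl  : ∀ {w} → w ∼ w
  ∼-sym   : ∀ {w v} → w ∼ v → v ∼ w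
  ∼-trans : ∀ {w v z} → w ∼ v → v ∼ z → w ∼ z
  ∼-cong  : ∀ {a b x y} → a ∼ x → b ∼ y → (a ++ b) ∼ (x ++ y)
  r1  : ∀ {a b s} → 1 ≤ a → a ≤ b →
        (mk a s ∷ u b ∷ []) ∼ (mk a s ∷ p′ b ∷ [])
  r2  : ∀ {a b s} → 1 ≤ a → a < b →
        (u b ∷ mk a s ∷ []) ∼ (p′ b ∷ mk a s ∷ [])
  r3  : ∀ {a b c d s t} → 1 ≤ a → a ≤ b → b ≤ c → c < d →
        (mk a s ∷ u b ∷ u d ∷ mk c t ∷ []) ∼ (mk a s ∷ u d ∷ mk b t ∷ u c ∷ [])
  r4  : ∀ {a b c d s t} → 1 ≤ a → a ≤ b → b < c → c ≤ d →
        (mk a s ∷ u c ∷ u d ∷ mk b t ∷ []) ∼ (mk a s ∷ u c ∷ mk b t ∷ u d ∷ [])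
  r5  : ∀ {a b c d s t} → 1 ≤ a → a ≤ b → b < c → c < d →
        (u d ∷ mk a s ∷ u c ∷ mk b t ∷ []) ∼ (mk a s ∷ u d ∷ u c ∷ mk b t ∷ [])
  r6  : ∀ {a b c d s t} → 1 ≤ a → a < b → b ≤ c → c < d →
        (u b ∷ mk a s ∷ u d ∷ mk c t ∷ []) ∼ (mk b t ∷ u d ∷ mk a s ∷ u c ∷ [])
  r7  : ∀ {a b c d s t} → 1 ≤ a → a < b → b < c → c ≤ d →
        (u c ∷ mk b s ∷ u d ∷ mk a t ∷ []) ∼ (mk c s ∷ u d ∷ u b ∷ mk a t ∷ [])
  r8  : ∀ {a b c d s t} → 1 ≤ a → a < b → b ≤ c → c < d →
        (u d ∷ mk b s ∷ u c ∷ mk a t ∷ []) ∼ (mk b s ∷ u d ∷ u c ∷ mk a t ∷ [])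
  r9  : ∀ {a b c d s t} → 1 ≤ a → a < b → b ≤ c → c ≤ d →
        (mk b s ∷ u c ∷ u d ∷ mk a t ∷ []) ∼ (mk b s ∷ u c ∷ mk a t ∷ u d ∷ [])
  r10 : ∀ {a b c d s t} → 1 ≤ a → a ≤ b → b < c → c ≤ d →
        (u c ∷ mk a s ∷ u d ∷ mk b t ∷ []) ∼ (mk c t ∷ u d ∷ mk a s ∷ u b ∷ [])

down : (ℕ → ℕ) → ℕ → ℕ → Word
down y lo zero    = []
down y lo (suc k) = u (y (lo + k)) ∷ down y lo k

{-# OPTIONS --safe #-}
-- The letter x• sinks through the word in two phases. First it overtakes the
-- letters y_N, …, y_(i+1) one at a time: the step
-- x• y_(j+1) y_j y_(j-1) ∼ y_(j+1) x• y_j y_(j-1) is relation (5) if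
-- x ≤ y_(j-1) and relation (8) otherwise.
-- Then x• meets y_i y_(i-1): relation (7) unprimes x, hands its flag to
-- y_(i-1) and moves y_i behind it; repeating this with y_(i-1) in the role of
-- x passes the flag down to y_1 and carries y_i to just before y_0°.
-- When x ≤ y_1 only the first phase is needed, with i = 1.
module Submission where

open import Defs
open import Data.Nat using (ℕ; zero; suc; _+_; _≤_; _<_; _∸_; s≤s; z≤n)
open import Data.Nat.Properties
open import Data.Bool using (Bool; false)
open import Data.List using ([]; _∷_; _++_)
open import Data.List.Properties using (++-assoc)
open import Data.Product using (_×_; _,_)
open import Relation.Binary.PropositionalEquality
open import Relation.Nullary using (yes; no)
open import Relation.Binary.Bundles using (Setoid)

Increasing : ℕ → (ℕ → ℕ) → Set
Increasing N y = ∀ j → j < N → y j < y (suc j)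

∼-setoid : Setoid _ _
∼-setoid = record
  { Carrier = Word ; _≈_ = _∼_
  ; isEquivalence = record { refl = ∼-refl ; sym = ∼-sym ; trans = ∼-trans } }

open import Relation.Binary.Reasoning.Setoid ∼-setoid

∼-congˡ : ∀ w {v v′} → v ∼ v′ → (w ++ v) ∼ (w ++ v′)
∼-congˡ w = ∼-cong (∼-refl {w})

∼-congʳ : ∀ {w w′} v → w ∼ w′ → (w ++ v) ∼ (w′ ++ v)
∼-congʳ v p = ∼-cong p (∼-refl {v})

down-suc-++ : (y : ℕ → ℕ) (lo k : ℕ) (W : Word) →
  down y lo (suc k) ++ W ≡ down y (suc lo) k ++ u (y lo) ∷ W
down-suc-++ y lo zero    W = cong (λ n → u (y n) ∷ W) (+-identityʳ lo)
down-suc-++ y lo (suc k) W =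
  cong₂ _∷_ (cong (λ n → u (y n)) (+-suc lo k)) (down-suc-++ y lo k W)

down-+ : (y : ℕ → ℕ) (lo m k : ℕ) → down y lo (m + k) ≡ down y (lo + m) k ++ down y lo m
down-+ y lo m zero    rewrite +-identityʳ m = refl
down-+ y lo m (suc k) rewrite +-suc m k =
  cong₂ _∷_ (cong (λ n → u (y n)) (sym (+-assoc lo m k))) (down-+ y lo m k)

increasing⇒positive : ∀ {N y} → 1 ≤ y 0 → Increasing N y → ∀ a → a ≤ N → 1 ≤ y a
increasing⇒positive y₀ inc zero    _   = y₀
increasing⇒positive y₀ inc (suc a) a<N =
  ≤-trans (increasing⇒positive y₀ inc a (<⇒≤ a<N)) (<⇒≤ (inc a a<N))

overtake : ∀ {x v c d s b} → 1 ≤ x → 1 ≤ v → x ≤ c → v < c → c < d →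
  (mk x s ∷ u d ∷ u c ∷ mk v b ∷ []) ∼ (u d ∷ mk x s ∷ u c ∷ mk v b ∷ [])
overtake {x} {v} x≥1 v≥1 x≤c v<c c<d with x ≤? v
... | yes x≤v = ∼-sym (r5 x≥1 x≤v v<c c<d)
... | no  x≰v = ∼-sym (r8 v≥1 (≰⇒> x≰v) x≤c c<d)

overtake-down : ∀ {N y} → Increasing N y → ∀ {x} → 1 ≤ x → (s : Bool) →
  (k j v : ℕ) (b : Bool) (R : Word) → j + k ≤ N → x ≤ y j → 1 ≤ v → v < y j →
  (mk x s ∷ down y (suc j) k ++ u (y j) ∷ mk v b ∷ R)
    ∼ (down y (suc j) k ++ mk x s ∷ u (y j) ∷ mk v b ∷ R)
overtake-down inc x≥1 s zero    j v b R _ _ _ _ = ∼-refl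
overtake-down {N} {y} inc {x} x≥1 s (suc k) j v b R j+k<N x≤yj v≥1 v<yj = begin
  mk x s ∷ down y (suc j) (suc k) ++ u (y j) ∷ mk v b ∷ R
    ≡⟨ cong (mk x s ∷_) (down-suc-++ y (suc j) k _) ⟩
  mk x s ∷ down y (suc (suc j)) k ++ u (y (suc j)) ∷ u (y j) ∷ mk v b ∷ R
    ≈⟨ overtake-down inc x≥1 s k (suc j) (y j) false (mk v b ∷ R)
         (subst (_≤ N) (+-suc j k) j+k<N) (≤-trans x≤yj (<⇒≤ yj<yj′)) yj≥1 yj<yj′ ⟩
  down y (suc (suc j)) k ++ mk x s ∷ u (y (suc j)) ∷ u (y j) ∷ mk v b ∷ R
    ≈⟨ ∼-congˡ (down y (suc (suc j)) k)
         (∼-congʳ R (overtake x≥1 v≥1 x≤yj v<yj yj<yj′)) ⟩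
  down y (suc (suc j)) k ++ u (y (suc j)) ∷ mk x s ∷ u (y j) ∷ mk v b ∷ R
    ≡⟨ sym (down-suc-++ y (suc j) k _) ⟩
  down y (suc j) (suc k) ++ mk x s ∷ u (y j) ∷ mk v b ∷ R ∎
  where
  yj<yj′ : y j < y (suc j)
  yj<yj′ = inc j (≤-trans (s≤s (m≤m+n j k)) (subst (_≤ N) (+-suc j k) j+k<N))
  yj≥1 : 1 ≤ y j
  yj≥1 = ≤-trans v≥1 (<⇒≤ v<yj)

transfer-bullet : ∀ {N y} → Increasing N y → 1 ≤ y 0 → (t : Bool) →
  (m : ℕ) → suc m < N → (z w : ℕ) (s : Bool) → y (suc m) < z → z ≤ w →
  (mk z s ∷ u w ∷ down y 1 (suc m) ++ mk (y 0) t ∷ [])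
    ∼ (u z ∷ down y 2 m ++ mk (y 1) s ∷ u w ∷ mk (y 0) t ∷ [])
transfer-bullet inc y₀ t zero m<N z w s y₁<z z≤w =
  ∼-sym (r7 y₀ (inc 0 (<⇒≤ m<N)) y₁<z z≤w)
transfer-bullet {N} {y} inc y₀ t (suc m) m<N z w s b<z z≤w = begin
  mk z s ∷ u w ∷ u (y (suc (suc m))) ∷ u (y (suc m)) ∷ rest
    ≈⟨ ∼-congʳ rest (∼-sym (r7 ym≥1 (inc (suc m) m′<N) b<z z≤w)) ⟩
  u z ∷ mk (y (suc (suc m))) s ∷ u w ∷ u (y (suc m)) ∷ rest
    ≈⟨ ∼-congˡ (u z ∷ [])
         (transfer-bullet inc y₀ t m m′<N _ w s (inc (suc m) m′<N) (≤-trans (<⇒≤ b<z) z≤w)) ⟩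
  u z ∷ down y 2 (suc m) ++ mk (y 1) s ∷ u w ∷ mk (y 0) t ∷ [] ∎
  where
  rest : Word
  rest = down y 1 m ++ mk (y 0) t ∷ []
  m′<N : suc m < N
  m′<N = <-trans (n<1+n _) m<N
  ym≥1 : 1 ≤ y (suc m)
  ym≥1 = increasing⇒positive y₀ inc (suc m) (<⇒≤ m′<N)

sink-between : ∀ {N y} → Increasing N y → 1 ≤ y 0 → ∀ {x} → 1 ≤ x → (s t : Bool) →
  (m : ℕ) → 2 + m ≤ N → y (suc m) < x → x ≤ y (2 + m) →
  (mk x s ∷ down y 1 N ++ mk (y 0) t ∷ [])
    ∼ (down y (3 + m) (N ∸ (2 + m)) ++ u x ∷ down y 2 m
        ++ mk (y 1) s ∷ u (y (2 + m)) ∷ mk (y 0) t ∷ [])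
sink-between {N} {y} inc y₀ {x} x≥1 s t m i≤N y<x x≤yi = begin
  mk x s ∷ down y 1 N ++ tail₀
    ≡⟨ cong (λ L → mk x s ∷ L ++ tail₀) split ⟩
  mk x s ∷ (above ++ down y 1 i) ++ tail₀
    ≡⟨ cong (mk x s ∷_) (++-assoc above (down y 1 i) tail₀) ⟩
  mk x s ∷ above ++ down y 1 i ++ tail₀
    ≈⟨ overtake-down inc x≥1 s (N ∸ i) i (y (suc m)) false (down y 1 m ++ tail₀)
         (≤-reflexive (m+[n∸m]≡n i≤N)) x≤yi
         (increasing⇒positive y₀ inc (suc m) (<⇒≤ i≤N)) (inc (suc m) i≤N) ⟩
  above ++ mk x s ∷ down y 1 i ++ tail₀
    ≈⟨ ∼-congˡ above (transfer-bullet inc y₀ t m i≤N x (y i) s y<x x≤yi) ⟩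
  above ++ u x ∷ down y 2 m ++ mk (y 1) s ∷ u (y i) ∷ tail₀ ∎
  where
  i : ℕ
  i = 2 + m
  tail₀ : Word
  tail₀ = mk (y 0) t ∷ []
  above : Word
  above = down y (suc i) (N ∸ i)
  split : down y 1 N ≡ above ++ down y 1 i
  split = trans (cong (down y 1) (sym (m+[n∸m]≡n i≤N))) (down-+ y 1 i (N ∸ i))

sink-below : ∀ {n y} → Increasing (2 + n) y → 1 ≤ y 0 → ∀ {x} → 1 ≤ x → (s t : Bool) →
  x ≤ y 1 →
  (mk x s ∷ down y 1 (2 + n) ++ mk (y 0) t ∷ [])
    ∼ (down y 2 (suc n) ++ mk x s ∷ u (y 1) ∷ mk (y 0) t ∷ [])
sink-below {n} {y} inc y₀ {x} x≥1 s t x≤y₁ = begin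
  mk x s ∷ down y 1 (2 + n) ++ tail₀
    ≡⟨ cong (mk x s ∷_) (down-suc-++ y 1 (suc n) tail₀) ⟩
  mk x s ∷ down y 2 (suc n) ++ u (y 1) ∷ tail₀
    ≈⟨ overtake-down inc x≥1 s (suc n) 1 (y 0) t [] ≤-refl x≤y₁ y₀ (inc 0 (s≤s z≤n)) ⟩
  down y 2 (suc n) ++ mk x s ∷ u (y 1) ∷ tail₀ ∎
  where
  tail₀ : Word
  tail₀ = mk (y 0) t ∷ []

mainTheorem15 : (N : ℕ) → 2 ≤ N → (y : ℕ → ℕ) → 1 ≤ y 0 →
    (∀ j → j < N → y j < y (suc j)) →
    (x : ℕ) → 1 ≤ x → (s t : Bool) →
    ((i : ℕ) → 2 ≤ i → i ≤ N → y (i ∸ 1) < x → x ≤ y i →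
      (mk x s ∷ down y 1 N ++ mk (y 0) t ∷ [])
        ∼ (down y (suc i) (N ∸ i) ++ u x ∷ down y 2 (i ∸ 2)
            ++ mk (y 1) s ∷ u (y i) ∷ mk (y 0) t ∷ []))
    × (x ≤ y 1 →
      (mk x s ∷ down y 1 N ++ mk (y 0) t ∷ [])
        ∼ (down y 2 (N ∸ 1) ++ mk x s ∷ u (y 1) ∷ mk (y 0) t ∷ []))
mainTheorem15 (suc zero) (s≤s ())
mainTheorem15 (suc (suc n)) _ y y₀ inc x x≥1 s t = between , sink-below inc y₀ x≥1 s t
  where
  between : (i : ℕ) → 2 ≤ i → i ≤ 2 + n → y (i ∸ 1) < x → x ≤ y i →
    (mk x s ∷ down y 1 (2 + n) ++ mk (y 0) t ∷ [])
      ∼ (down y (suc i) (2 + n ∸ i) ++ u x ∷ down y 2 (i ∸ 2)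
          ++ mk (y 1) s ∷ u (y i) ∷ mk (y 0) t ∷ [])
  between (suc zero) (s≤s ())
  between (suc (suc m)) _ = sink-between inc y₀ x≥1 s t m
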